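{- For any $d>0$ and all sufficiently large $t$, there exists a set $\mathcal{H}\subseteq \mathbb{R}^{d\times d}$ of matrices with integer entries in $[-t,t]$ such that $|\mathcal{H}| = t^{\Omega(d^2)}$ and (1) every $T\in\mathcal{H}$ is non-singular; (2) for any $S,T\in\mathcal{H}$ with $S\neq T$, $S^{ -1}e_d \ne T^{ -1}e_d$, where $e_d$ is the $d$-th standard basis vector. -}

module Defs where

open import Data.Nat using (ℕ; zero; suc)
open import Data.Fin using (Fin; fromℕ; _≟_)
import Data.Integer as ℤ
open import Data.Integer using (ℤ)
open import Data.Rational using (ℚ; 0ℚ; 1ℚ; _+_; _*_)
open import Data.Bool using (true; false)
open import Relation.Nullary using (does)
open import Relation.Binary.PropositionalEquality using (_≡_)
open import Data.Product using (_×_)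

IntMatrix : ℕ → Set
IntMatrix d = Fin d → Fin d → ℤ

QMatrix : ℕ → Set
QMatrix d = Fin d → Fin d → ℚ

QVec : ℕ → Set
QVec d = Fin d → ℚ

_≐ₘ_ : ∀ {d} → IntMatrix d → IntMatrix d → Set
S ≐ₘ T = ∀ i j → S i j ≡ T i j

_≐ᵥ_ : ∀ {d} → QVec d → QVec d → Set
u ≐ᵥ v = ∀ i → u i ≡ v i

∑ : ∀ {n} → (Fin n → ℚ) → ℚ
∑ {zero} f = 0ℚ
∑ {suc n} f = f Fin.zero + ∑ (λ i → f (Fin.suc i))

toQ : ∀ {d} → IntMatrix d → QMatrix d
toQ S i j = Data.Rational._/_ (S i j) 1

_⊗_ : ∀ {d} → QMatrix d → QMatrix d → QMatrix d
(A ⊗ B) i j = ∑ (λ k → A i k * B k j)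

mulVec : ∀ {d} → QMatrix d → QVec d → QVec d
mulVec A v i = ∑ (λ k → A i k * v k)

identity : ∀ {d} → QMatrix d
identity i j with does (i ≟ j)
... | true = 1ℚ
... | false = 0ℚ

IsInverse : ∀ {d} → QMatrix d → QMatrix d → Set
IsInverse {d} A B = (∀ i j → (A ⊗ B) i j ≡ identity i j) × (∀ i j → (B ⊗ A) i j ≡ identity i j)

-- non-singular (= invertible over ℚ ⊆ ℝ)
NonSingular : ∀ {d} → IntMatrix d → Set
NonSingular {d} S = Data.Product.∃ λ (B : QMatrix d) → IsInverse (toQ S) B

-- e_d, the last standard basis vector of ℚ^(suc n)
lastBasis : ∀ n → QVec (suc n)
lastBasis n i with does (i ≟ fromℕ n)
... | true = 1ℚ
... | false = 0ℚ

-- The matrices are built by bordering: T = [[1, −c], [0, S]] with S a member of the family one size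
-- smaller and c a row of digits in [0, g] whose first entry is shifted by g + 1; the 1 × 1 members are
-- [u + 1] with u ≤ g. If T x = e_d, then the tail y of x solves S y = e_d and x₀ = c · y. By induction
-- every such solution is superincreasing (each coordinate exceeds g times the sum of the later ones;
-- the shift of c₀ gives x₀ ≥ (g + 1) y₀), so the digits of c are recovered from x₀ as in a mixed-radix
-- expansion, and x = T⁻¹ e_d determines T. With g = ⌊(t − 1)/2⌋ the entries lie in [−t, t] and there
-- are (g + 1)^(1 + d(d − 1)/2) ≥ t^(d²/8) matrices.

module Submission where

open import Defs

module Construction where

  open import Algebra.Bundles using (CommutativeMonoid; Ring)
  open import Data.Bool using (true; false)
  open import Data.Fin using (Fin; zero; suc; fromℕ; _≟_; punchIn)
  open import Data.Fin.Properties using (punchInᵢ≢i)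
  open import Data.Integer using (ℤ; ∣_∣)
  import Data.Integer as ℤ
  import Data.Integer.Properties as ℤP
  open import Data.List using (List; []; _∷_; [_]; map; upTo; cartesianProductWith; length)
  open import Data.List.Membership.Propositional using (_∈_)
  open import Data.List.Membership.Propositional.Properties using (∈-map⁻; ∈-cartesianProductWith⁻; ∈-upTo⁻)
  import Data.List.Properties as ListP
  import Data.List.Relation.Unary.All as All
  open import Data.List.Relation.Unary.AllPairs using (AllPairs; []; _∷_)
  open import Data.List.Relation.Unary.Unique.Propositional using (Unique)
  import Data.List.Relation.Unary.Unique.Propositional.Properties as UniqueP
  import Data.List.Relation.Unary.Unique.Setoid.Properties as UniqueS
  open import Data.Nat as ℕ using (ℕ; _^_)
  import Data.Nat.Coprimality as Cop
  import Data.Nat.Properties as ℕP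
  open import Data.Product using (_×_; _,_; ∃; ∃₂)
  open import Data.Rational using (ℚ; mkℚ; 0ℚ; 1ℚ; _+_; _*_; -_; _/_; _≤_; _<_; *≤*; ↥_; nonNegative; NonZero; 1/_)
  open import Data.Rational.Properties hiding (_≟_)
  open import Data.Vec using (Vec; []; _∷_; lookup)
  open import Data.Vec.Functional using (tail)
  import Data.Vec.Functional.Relation.Binary.Equality.Setoid as Pointwise
  import Data.Vec.Properties as VecP
  open import Function using (_∘_; flip)
  open import Relation.Binary.Bundles using (Setoid)
  open import Relation.Binary.Definitions using (tri<; tri≈; tri>)
  open import Relation.Binary.PropositionalEquality using (_≡_; _≢_; refl; sym; trans; cong; cong₂; subst; subst₂; module ≡-Reasoning)
  import Relation.Binary.PropositionalEquality as ≡
  open import Relation.Nullary using (does; ¬_; contradiction)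
  open import Relation.Nullary.Decidable using (dec-true; dec-false)

  open import Algebra.Properties.Group +-0-group using (∙-cancelˡ; x∙y⁻¹≈ε⇒x≈y)
  open import Algebra.Properties.CommutativeSemigroup (CommutativeMonoid.commutativeSemigroup *-1-commutativeMonoid)
    using (x∙yz≈y∙xz)
  import Algebra.Properties.Semiring.Sum (Ring.semiring +-*-ring) as Sum
  open Pointwise using (≋-setoid)

  ∑≡sum : ∀ {n} (f : Fin n → ℚ) → ∑ f ≡ Sum.sum f
  ∑≡sum {ℕ.zero} f = refl
  ∑≡sum {ℕ.suc n} f = cong (f zero +_) (∑≡sum (tail f))

  ∑-cong : ∀ {n} {f g : Fin n → ℚ} → (∀ i → f i ≡ g i) → ∑ f ≡ ∑ g
  ∑-cong {f = f} {g} f≗g = trans (∑≡sum f) (trans (Sum.sum-cong-≗ f≗g) (sym (∑≡sum g)))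

  ∑-zero : ∀ {n} {f : Fin n → ℚ} → (∀ i → f i ≡ 0ℚ) → ∑ f ≡ 0ℚ
  ∑-zero {n} f≗0 = trans (∑-cong f≗0) (trans (∑≡sum {n} (λ _ → 0ℚ)) (Sum.sum-replicate-zero n))

  ∑-*ˡ : ∀ {n} c (f : Fin n → ℚ) → ∑ (λ i → c * f i) ≡ c * ∑ f
  ∑-*ˡ c f = trans (∑≡sum (λ i → c * f i)) (sym (trans (cong (c *_) (∑≡sum f)) (Sum.*-distribˡ-sum c f)))

  ∑-*ʳ : ∀ {n} c (f : Fin n → ℚ) → ∑ (λ i → f i * c) ≡ ∑ f * c
  ∑-*ʳ c f = trans (∑≡sum (λ i → f i * c)) (sym (trans (cong (_* c) (∑≡sum f)) (Sum.*-distribʳ-sum c f)))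

  ∑-neg : ∀ {n} (f : Fin n → ℚ) → ∑ (λ i → - f i) ≡ - ∑ f
  ∑-neg {ℕ.zero} f = refl
  ∑-neg {ℕ.suc n} f = trans (cong (- f zero +_) (∑-neg (tail f))) (sym (neg-distrib-+ (f zero) _))

  ∑-comm : ∀ {m n} (f : Fin m → Fin n → ℚ) → ∑ (λ i → ∑ (f i)) ≡ ∑ (λ j → ∑ (λ i → f i j))
  ∑-comm f = trans (∑∑≡sumsum f) (trans (Sum.∑-comm f) (sym (∑∑≡sumsum (flip f))))
    where
    ∑∑≡sumsum : ∀ {m n} (f : Fin m → Fin n → ℚ) → ∑ (λ i → ∑ (f i)) ≡ Sum.sum (λ i → Sum.sum (f i))
    ∑∑≡sumsum f = trans (∑≡sum (λ i → ∑ (f i))) (Sum.sum-cong-≗ (λ i → ∑≡sum (f i)))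

  ∑-single : ∀ {n} (f : Fin (ℕ.suc n) → ℚ) j → (∀ i → i ≢ j → f i ≡ 0ℚ) → ∑ f ≡ f j
  ∑-single f j f≡0 = begin
    ∑ f                                ≡⟨ ∑≡sum f ⟩
    Sum.sum f                          ≡⟨ Sum.sum-remove {i = j} f ⟩
    f j + Sum.sum (f ∘ punchIn j)      ≡⟨ cong (f j +_) (sym (∑≡sum (f ∘ punchIn j))) ⟩
    f j + ∑ (f ∘ punchIn j)            ≡⟨ cong (f j +_) (∑-zero (λ i → f≡0 (punchIn j i) (punchInᵢ≢i j i))) ⟩
    f j + 0ℚ                           ≡⟨ +-identityʳ (f j) ⟩
    f j                                ∎
    where open ≡-Reasoning

  ∑-nonNeg : ∀ {m} (f : Fin m → ℚ) → (∀ k → 0ℚ ≤ f k) → 0ℚ ≤ ∑ f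
  ∑-nonNeg {ℕ.zero}  f f≥0 = ≤-refl
  ∑-nonNeg {ℕ.suc m} f f≥0 = +-mono-≤ (f≥0 zero) (∑-nonNeg (tail f) (f≥0 ∘ suc))

  identity-diag : ∀ {d} (i : Fin d) → identity i i ≡ 1ℚ
  identity-diag i with does (i ≟ i) | dec-true (i ≟ i) refl
  ... | true | _ = refl

  identity-offdiag : ∀ {d} {i j : Fin d} → i ≢ j → identity i j ≡ 0ℚ
  identity-offdiag {i = i} {j} i≢j with does (i ≟ j) | dec-false (i ≟ j) i≢j
  ... | false | _ = refl

  ∑-identityˡ : ∀ {n} (f : Fin n → ℚ) i → ∑ (λ k → identity i k * f k) ≡ f i
  ∑-identityˡ {ℕ.suc n} f i = begin
    ∑ (λ k → identity i k * f k) ≡⟨ ∑-single _ i (λ k k≢i →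
                                      trans (cong (_* f k) (identity-offdiag (k≢i ∘ sym))) (*-zeroˡ (f k))) ⟩
    identity i i * f i           ≡⟨ cong (_* f i) (identity-diag i) ⟩
    1ℚ * f i                     ≡⟨ *-identityˡ (f i) ⟩
    f i                          ∎
    where open ≡-Reasoning

  ∑-identityʳ : ∀ {n} (f : Fin n → ℚ) j → ∑ (λ k → f k * identity k j) ≡ f j
  ∑-identityʳ {ℕ.suc n} f j = begin
    ∑ (λ k → f k * identity k j) ≡⟨ ∑-single _ j (λ k k≢j →
                                      trans (cong (f k *_) (identity-offdiag k≢j)) (*-zeroʳ (f k))) ⟩
    f j * identity j j           ≡⟨ cong (f j *_) (identity-diag j) ⟩
    f j * 1ℚ                     ≡⟨ *-identityʳ (f j) ⟩
    f j                          ∎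
    where open ≡-Reasoning

  lastBasis-suc : ∀ n (i : Fin (ℕ.suc n)) → lastBasis (ℕ.suc n) (suc i) ≡ lastBasis n i
  lastBasis-suc n i with does (i ≟ fromℕ n)
  ... | true = refl
  ... | false = refl

  ∑-*-∑-assoc : ∀ {m n} (f : Fin m → ℚ) (M : Fin m → Fin n → ℚ) (g : Fin n → ℚ) →
                ∑ (λ k → f k * ∑ (λ l → M k l * g l)) ≡ ∑ (λ l → ∑ (λ k → f k * M k l) * g l)
  ∑-*-∑-assoc f M g = begin
    ∑ (λ k → f k * ∑ (λ l → M k l * g l))   ≡⟨ ∑-cong (λ k → sym (∑-*ˡ (f k) (λ l → M k l * g l))) ⟩
    ∑ (λ k → ∑ (λ l → f k * (M k l * g l))) ≡⟨ ∑-comm (λ k l → f k * (M k l * g l)) ⟩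
    ∑ (λ l → ∑ (λ k → f k * (M k l * g l))) ≡⟨ ∑-cong (λ l → ∑-cong (λ k → sym (*-assoc (f k) (M k l) (g l)))) ⟩
    ∑ (λ l → ∑ (λ k → f k * M k l * g l))   ≡⟨ ∑-cong (λ l → ∑-*ʳ (g l) (λ k → f k * M k l)) ⟩
    ∑ (λ l → ∑ (λ k → f k * M k l) * g l)   ∎
    where open ≡-Reasoning

  mulVec-congˡ : ∀ {d} {A A′ : QMatrix d} → (∀ i j → A i j ≡ A′ i j) → ∀ x → mulVec A x ≐ᵥ mulVec A′ x
  mulVec-congˡ A≐A′ x i = ∑-cong (λ k → cong (_* x k) (A≐A′ i k))

  mulVec-congʳ : ∀ {d} (A : QMatrix d) {x y : QVec d} → x ≐ᵥ y → mulVec A x ≐ᵥ mulVec A y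
  mulVec-congʳ A x≐y i = ∑-cong (λ k → cong (A i k *_) (x≐y k))

  mulVec-inverse : ∀ {d} {A B : QMatrix d} → IsInverse A B → ∀ v → mulVec A (mulVec B v) ≐ᵥ v
  mulVec-inverse {A = A} {B} (AB≡I , _) v i = begin
    ∑ (λ k → A i k * ∑ (λ l → B k l * v l)) ≡⟨ ∑-*-∑-assoc (A i) B v ⟩
    ∑ (λ l → (A ⊗ B) i l * v l)             ≡⟨ ∑-cong (λ l → cong (_* v l) (AB≡I i l)) ⟩
    ∑ (λ l → identity i l * v l)            ≡⟨ ∑-identityˡ v i ⟩
    v i                                     ∎
    where open ≡-Reasoning

  IsInverse-respˡ : ∀ {d} {A A′ B : QMatrix d} → (∀ i j → A i j ≡ A′ i j) → IsInverse A B → IsInverse A′ B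
  IsInverse-respˡ {B = B} A≐A′ (AB≡I , BA≡I) =
    (λ i j → trans (∑-cong (λ k → cong (_* B k j) (sym (A≐A′ i k)))) (AB≡I i j)) ,
    (λ i j → trans (∑-cong (λ k → cong (B i k *_) (sym (A≐A′ k j)))) (BA≡I i j))

  bordered : ∀ {m} → (Fin m → ℚ) → QMatrix m → QMatrix (ℕ.suc m)
  bordered c A zero    zero    = 1ℚ
  bordered c A zero    (suc j) = - c j
  bordered c A (suc i) zero    = 0ℚ
  bordered c A (suc i) (suc j) = A i j

  borderedInverse : ∀ {m} → (Fin m → ℚ) → QMatrix m → QMatrix (ℕ.suc m)
  borderedInverse c B zero    zero    = 1ℚ
  borderedInverse c B zero    (suc j) = ∑ (λ k → c k * B k j)
  borderedInverse c B (suc i) zero    = 0ℚ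
  borderedInverse c B (suc i) (suc j) = B i j

  bordered-isInverse : ∀ {m} c {A B : QMatrix m} → IsInverse A B → IsInverse (bordered c A) (borderedInverse c B)
  bordered-isInverse c {A} {B} (AB≡I , BA≡I) = left , right
    where
    open ≡-Reasoning
    cB : Fin _ → ℚ
    cB j = ∑ (λ k → c k * B k j)
    left : ∀ i j → (bordered c A ⊗ borderedInverse c B) i j ≡ identity i j
    left zero zero = cong (1ℚ * 1ℚ +_) (∑-zero (λ k → *-zeroʳ (- c k)))
    left zero (suc j) = begin
      1ℚ * cB j + ∑ (λ k → - c k * B k j) ≡⟨ cong₂ _+_ (*-identityˡ (cB j))
                                                       (∑-cong (λ k → sym (neg-distribˡ-* (c k) (B k j)))) ⟩
      cB j + ∑ (λ k → - (c k * B k j))    ≡⟨ cong (cB j +_) (∑-neg (λ k → c k * B k j)) ⟩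
      cB j + - cB j                       ≡⟨ +-inverseʳ (cB j) ⟩
      0ℚ                                  ∎
    left (suc i) zero = cong (0ℚ * 1ℚ +_) (∑-zero (λ k → *-zeroʳ (A i k)))
    left (suc i) (suc j) = trans (cong₂ _+_ (*-zeroˡ (cB j)) (AB≡I i j)) (+-identityˡ (identity i j))
    right : ∀ i j → (borderedInverse c B ⊗ bordered c A) i j ≡ identity i j
    right zero zero = cong (1ℚ * 1ℚ +_) (∑-zero (λ k → *-zeroʳ (cB k)))
    right zero (suc j) = begin
      1ℚ * - c j + ∑ (λ k → cB k * A k j) ≡⟨ cong₂ _+_ (*-identityˡ (- c j)) (sym (∑-*-∑-assoc c B (λ k → A k j))) ⟩
      - c j + ∑ (λ l → c l * (B ⊗ A) l j) ≡⟨ cong (- c j +_) (∑-cong (λ l → cong (c l *_) (BA≡I l j))) ⟩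
      - c j + ∑ (λ l → c l * identity l j) ≡⟨ cong (- c j +_) (∑-identityʳ c j) ⟩
      - c j + c j                          ≡⟨ +-inverseˡ (c j) ⟩
      0ℚ                                   ∎
    right (suc i) zero = cong (0ℚ * 1ℚ +_) (∑-zero (λ k → *-zeroʳ (B i k)))
    right (suc i) (suc j) = trans (cong₂ _+_ (*-zeroˡ (- c j)) (BA≡I i j)) (+-identityˡ (identity i j))

  Solves : ∀ {n} → QMatrix (ℕ.suc n) → QVec (ℕ.suc n) → Set
  Solves {n} A x = mulVec A x ≐ᵥ lastBasis n

  bordered-solves⁻ : ∀ {n} c {A : QMatrix (ℕ.suc n)} {x} → Solves (bordered c A) x →
                     x zero ≡ ∑ (λ k → c k * tail x k) × Solves A (tail x)
  bordered-solves⁻ {n} c {A} {x} sol = head-eq , tail-sol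
    where
    open ≡-Reasoning
    head-eq : x zero ≡ ∑ (λ k → c k * tail x k)
    head-eq = x∙y⁻¹≈ε⇒x≈y _ _ (begin
      x zero + - ∑ (λ k → c k * tail x k)
        ≡⟨ cong₂ _+_ (sym (*-identityˡ (x zero))) (sym (∑-neg (λ k → c k * tail x k))) ⟩
      1ℚ * x zero + ∑ (λ k → - (c k * tail x k))
        ≡⟨ cong (1ℚ * x zero +_) (∑-cong (λ k → neg-distribˡ-* (c k) (tail x k))) ⟩
      mulVec (bordered c A) x zero
        ≡⟨ sol zero ⟩
      0ℚ
        ∎)
    tail-sol : Solves A (tail x)
    tail-sol i = begin
      mulVec A (tail x) i                    ≡⟨ sym (+-identityˡ _) ⟩
      0ℚ + mulVec A (tail x) i               ≡⟨ cong (_+ mulVec A (tail x) i) (sym (*-zeroˡ (x zero))) ⟩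
      mulVec (bordered c A) x (suc i)        ≡⟨ sol (suc i) ⟩
      lastBasis (ℕ.suc n) (suc i)            ≡⟨ lastBasis-suc n i ⟩
      lastBasis n i                          ∎

  *-nonNeg : ∀ {p q} → 0ℚ ≤ p → 0ℚ ≤ q → 0ℚ ≤ p * q
  *-nonNeg {p} {q} p≥0 q≥0 = subst (_≤ p * q) (*-zeroʳ p) (*-monoˡ-≤-nonNeg p {{nonNegative p≥0}} q≥0)

  *-inverse-unique : ∀ {a b x : ℚ} → a * x ≡ 1ℚ → b * x ≡ 1ℚ → a ≡ b
  *-inverse-unique {a} {b} {x} ax≡1 bx≡1 = begin
    a            ≡⟨ sym (*-identityʳ a) ⟩
    a * 1ℚ       ≡⟨ cong (a *_) (sym bx≡1) ⟩
    a * (b * x)  ≡⟨ x∙yz≈y∙xz a b x ⟩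
    b * (a * x)  ≡⟨ cong (b *_) ax≡1 ⟩
    b * 1ℚ       ≡⟨ *-identityʳ b ⟩
    b            ∎
    where open ≡-Reasoning

  *-inverse-positive : ∀ {a x : ℚ} → 0ℚ ≤ a → a * x ≡ 1ℚ → 0ℚ < x
  *-inverse-positive {a} {x} a≥0 ax≡1 =
    *-cancelˡ-<-nonNeg a {{nonNegative a≥0}} (subst₂ _<_ (sym (*-zeroʳ a)) (sym ax≡1) (positive⁻¹ 1ℚ))

  ι : ℕ → ℚ
  ι n = ℤ.+ n / 1

  ι≡mkℚ : ∀ n → ι n ≡ mkℚ (ℤ.+ n) 0 (Cop.sym (Cop.1-coprimeTo n))
  ι≡mkℚ n = normalize-coprime (Cop.sym (Cop.1-coprimeTo n))

  ι-+ : ∀ m n → ι (m ℕ.+ n) ≡ ι m + ι n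
  ι-+ m n rewrite ι≡mkℚ m | ι≡mkℚ n =
    cong (_/ 1) (cong₂ ℤ._+_ (sym (ℤP.*-identityʳ (ℤ.+ m))) (sym (ℤP.*-identityʳ (ℤ.+ n))))

  ι-suc-* : ∀ n y → ι (ℕ.suc n) * y ≡ ι n * y + y
  ι-suc-* n y = begin
    ι (1 ℕ.+ n) * y        ≡⟨ cong (_* y) (trans (ι-+ 1 n) (+-comm 1ℚ (ι n))) ⟩
    (ι n + 1ℚ) * y         ≡⟨ *-distribʳ-+ y (ι n) 1ℚ ⟩
    ι n * y + 1ℚ * y       ≡⟨ cong (ι n * y +_) (*-identityˡ y) ⟩
    ι n * y + y            ∎
    where open ≡-Reasoning

  ι-mono-≤ : ∀ {m n} → m ℕ.≤ n → ι m ≤ ι n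
  ι-mono-≤ {m} {n} m≤n rewrite ι≡mkℚ m | ι≡mkℚ n =
    *≤* (subst₂ ℤ._≤_ (sym (ℤP.*-identityʳ (ℤ.+ m))) (sym (ℤP.*-identityʳ (ℤ.+ n))) (ℤ.+≤+ m≤n))

  ι-nonNeg : ∀ n → 0ℚ ≤ ι n
  ι-nonNeg n = ι-mono-≤ (ℕ.z≤n {n})

  ι-injective : ∀ {m n} → ι m ≡ ι n → m ≡ n
  ι-injective {m} {n} eq rewrite ι≡mkℚ m | ι≡mkℚ n = ℤP.+-injective (cong ↥_ eq)

  ι-neg : ∀ n → (ℤ.- ℤ.+ n) / 1 ≡ - ι n
  ι-neg ℕ.zero    = refl
  ι-neg (ℕ.suc n) = refl

  infix 7 _·_
  _·_ : ∀ {m} → (Fin m → ℕ) → QVec m → ℚ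
  u · y = ∑ (λ k → ι (u k) * y k)

  data Superincreasing (g : ℕ) : ∀ {m} → QVec m → Set where
    []  : {y : QVec 0} → Superincreasing g y
    _∷_ : ∀ {m} {y : QVec (ℕ.suc m)} → ι g * ∑ (tail y) < y zero → Superincreasing g (tail y) → Superincreasing g y

  module _ {g : ℕ} where

    superincreasing⇒nonNeg : ∀ {m} {y : QVec m} → Superincreasing g y → ∀ k → 0ℚ ≤ y k
    superincreasing⇒nonNeg {y = y} (dominates ∷ si) zero =
      <⇒≤ (≤-<-trans (*-nonNeg (ι-nonNeg g) (∑-nonNeg (tail y) (superincreasing⇒nonNeg si))) dominates)
    superincreasing⇒nonNeg (_ ∷ si) (suc k) = superincreasing⇒nonNeg si k

    ·-nonNeg : ∀ {m} (u : Fin m → ℕ) {y : QVec m} → Superincreasing g y → 0ℚ ≤ u · y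
    ·-nonNeg u si = ∑-nonNeg _ (λ k → *-nonNeg (ι-nonNeg (u k)) (superincreasing⇒nonNeg si k))

    ·-≤ : ∀ {m} {u : Fin m → ℕ} {y : QVec m} → Superincreasing g y → (∀ k → u k ℕ.≤ g) → u · y ≤ ι g * ∑ y
    ·-≤ [] _ = ≤-reflexive (sym (*-zeroʳ (ι g)))
    ·-≤ {u = u} {y} si@(_ ∷ si′) u≤g = begin
      ι (u zero) * y zero + tail u · tail y ≤⟨ +-mono-≤ (*-monoʳ-≤-nonNeg (y zero) {{y₀≥0}} (ι-mono-≤ (u≤g zero)))
                                                        (·-≤ si′ (u≤g ∘ suc)) ⟩
      ι g * y zero + ι g * ∑ (tail y)       ≡⟨ sym (*-distribˡ-+ (ι g) (y zero) (∑ (tail y))) ⟩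
      ι g * ∑ y                             ∎
      where
      open ≤-Reasoning
      y₀≥0 = nonNegative (superincreasing⇒nonNeg si zero)

    ·-<-head : ∀ {m} {u v : Fin (ℕ.suc m) → ℕ} {y : QVec (ℕ.suc m)} → Superincreasing g y → (∀ k → u k ℕ.≤ g) →
               u zero ℕ.< v zero → u · y < v · y
    ·-<-head {u = u} {v} {y} si@(dominates ∷ si′) u≤g u₀<v₀ = begin-strict
      ι u₀ * y₀ + tail u · tail y     ≤⟨ +-monoʳ-≤ (ι u₀ * y₀) (·-≤ si′ (u≤g ∘ suc)) ⟩
      ι u₀ * y₀ + ι g * ∑ (tail y)    <⟨ +-monoʳ-< (ι u₀ * y₀) dominates ⟩
      ι u₀ * y₀ + y₀                  ≡⟨ ι-suc-* u₀ y₀ ⟨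
      ι (ℕ.suc u₀) * y₀               ≤⟨ *-monoʳ-≤-nonNeg y₀ {{y₀≥0}} (ι-mono-≤ u₀<v₀) ⟩
      ι (v zero) * y₀                 ≡⟨ sym (+-identityʳ _) ⟩
      ι (v zero) * y₀ + 0ℚ            ≤⟨ +-monoʳ-≤ (ι (v zero) * y₀) (·-nonNeg (tail v) si′) ⟩
      v · y                           ∎
      where
      open ≤-Reasoning
      u₀ = u zero
      y₀ = y zero
      y₀≥0 = nonNegative (superincreasing⇒nonNeg si zero)

    ·-injective : ∀ {m} {u v : Fin m → ℕ} {y : QVec m} → Superincreasing g y →
                  (∀ k → u k ℕ.≤ g) → (∀ k → v k ℕ.≤ g) → u · y ≡ v · y → ∀ k → u k ≡ v k
    ·-injective {ℕ.suc m} {u} {v} si u≤g v≤g eq k with ℕP.<-cmp (u zero) (v zero)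
    ... | tri< u₀<v₀ _ _ = contradiction eq (<⇒≢ (·-<-head {v = v} si u≤g u₀<v₀))
    ... | tri> _ _ v₀<u₀ = contradiction (sym eq) (<⇒≢ (·-<-head {v = u} si v≤g v₀<u₀))
    ·-injective si u≤g v≤g eq zero | tri≈ _ u₀≡v₀ _ = u₀≡v₀
    ·-injective {u = u} {v} {y} (_ ∷ si′) u≤g v≤g eq (suc k) | tri≈ _ u₀≡v₀ _ =
      ·-injective si′ (u≤g ∘ suc) (v≤g ∘ suc) (∙-cancelˡ (ι (u zero) * y zero) _ _ eq′) k
      where
      eq′ : ι (u zero) * y zero + tail u · tail y ≡ ι (u zero) * y zero + tail v · tail y
      eq′ = trans eq (cong (λ a → ι a * y zero + tail v · tail y) (sym u₀≡v₀))

    superincreasing-cons : ∀ {m} {x : QVec (ℕ.suc (ℕ.suc m))} → Superincreasing g (tail x) →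
                           ι (ℕ.suc g) * x (suc zero) ≤ x zero → Superincreasing g x
    superincreasing-cons {x = x} si@(dominates ∷ _) hx₁≤x₀ = dominates′ ∷ si
      where
      open ≤-Reasoning
      x₁ = x (suc zero)
      dominates′ : ι g * ∑ (tail x) < x zero
      dominates′ = begin-strict
        ι g * (x₁ + ∑ (tail (tail x)))          ≡⟨ *-distribˡ-+ (ι g) x₁ _ ⟩
        ι g * x₁ + ι g * ∑ (tail (tail x))      <⟨ +-monoʳ-< (ι g * x₁) dominates ⟩
        ι g * x₁ + x₁                           ≡⟨ ι-suc-* g x₁ ⟨
        ι (ℕ.suc g) * x₁                        ≤⟨ hx₁≤x₀ ⟩
        x zero                                  ∎

  lookup-injective : ∀ {A : Set} {m} (xs ys : Vec A m) → (∀ k → lookup xs k ≡ lookup ys k) → xs ≡ ys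
  lookup-injective xs ys eq =
    trans (sym (VecP.tabulate∘lookup xs)) (trans (VecP.tabulate-cong eq) (VecP.tabulate∘lookup ys))

  length-cartesianProductWith : ∀ {A B C : Set} (f : A → B → C) xs ys →
                                length (cartesianProductWith f xs ys) ≡ length xs ℕ.* length ys
  length-cartesianProductWith f []       ys = refl
  length-cartesianProductWith f (x ∷ xs) ys = trans (ListP.length-++ (map (f x) ys))
    (cong₂ ℕ._+_ (ListP.length-map (f x) ys) (length-cartesianProductWith f xs ys))

  ≐ₘ-setoid : ℕ → Setoid _ _
  ≐ₘ-setoid d = ≋-setoid (Pointwise.≋-setoid (≡.setoid ℤ) d) d

  border : ∀ {m} → (Fin m → ℕ) → IntMatrix m → IntMatrix (ℕ.suc m)
  border c S zero    zero    = ℤ.+ 1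
  border c S zero    (suc j) = ℤ.- ℤ.+ c j
  border c S (suc i) zero    = ℤ.+ 0
  border c S (suc i) (suc j) = S i j

  toQ-border : ∀ {m} (c : Fin m → ℕ) (S : IntMatrix m) i j → toQ (border c S) i j ≡ bordered (ι ∘ c) (toQ S) i j
  toQ-border c S zero    zero    = refl
  toQ-border c S zero    (suc j) = ι-neg (c j)
  toQ-border c S (suc i) zero    = refl
  toQ-border c S (suc i) (suc j) = refl

  border-cong : ∀ {m} {c c′ : Fin m → ℕ} {S T : IntMatrix m} →
                (∀ k → c k ≡ c′ k) → S ≐ₘ T → border c S ≐ₘ border c′ T
  border-cong c≗c′ S≐T zero    zero    = refl
  border-cong c≗c′ S≐T zero    (suc j) = cong (λ a → ℤ.- ℤ.+ a) (c≗c′ j)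
  border-cong c≗c′ S≐T (suc i) zero    = refl
  border-cong c≗c′ S≐T (suc i) (suc j) = S≐T i j

  border-injective : ∀ {m} {c c′ : Fin m → ℕ} {S T : IntMatrix m} →
                     border c S ≐ₘ border c′ T → (∀ k → c k ≡ c′ k) × S ≐ₘ T
  border-injective eq = (λ k → ℤP.+-injective (ℤP.neg-injective (eq zero (suc k)))) , (λ i j → eq (suc i) (suc j))

  digitCount : ℕ → ℕ
  digitCount ℕ.zero    = 1
  digitCount (ℕ.suc n) = ℕ.suc n ℕ.+ digitCount n

  module Family (g : ℕ) where

    h : ℕ
    h = ℕ.suc g

    base : ℕ → IntMatrix 1
    base u _ _ = ℤ.+ ℕ.suc u

    coef : ∀ {m} → Vec ℕ (ℕ.suc m) → Fin (ℕ.suc m) → ℕ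
    coef (w₀ ∷ w) zero    = h ℕ.+ w₀
    coef (w₀ ∷ w) (suc k) = lookup w k

    extend : ∀ {m} → Vec ℕ (ℕ.suc m) → IntMatrix (ℕ.suc m) → IntMatrix (ℕ.suc (ℕ.suc m))
    extend w = border (coef w)

    digitVectors : ∀ m → List (Vec ℕ m)
    digitVectors ℕ.zero    = [ [] ]
    digitVectors (ℕ.suc m) = cartesianProductWith _∷_ (upTo h) (digitVectors m)

    family : ∀ n → List (IntMatrix (ℕ.suc n))
    family ℕ.zero    = map base (upTo h)
    family (ℕ.suc m) = cartesianProductWith extend (digitVectors (ℕ.suc m)) (family m)

    ∈-digitVectors⁻ : ∀ {m} {w : Vec ℕ m} → w ∈ digitVectors m → ∀ k → lookup w k ℕ.≤ g
    ∈-digitVectors⁻ {ℕ.suc m} w∈ k with ∈-cartesianProductWith⁻ _∷_ (upTo h) (digitVectors m) w∈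
    ∈-digitVectors⁻ w∈ zero    | u , _ , u∈ , _  , refl = ℕP.≤-pred (∈-upTo⁻ u∈)
    ∈-digitVectors⁻ w∈ (suc k) | _ , _ , _  , w∈′ , refl = ∈-digitVectors⁻ w∈′ k

    ∈-family-zero⁻ : ∀ {T} → T ∈ family 0 → ∃ λ u → u ℕ.≤ g × T ≡ base u
    ∈-family-zero⁻ T∈ with ∈-map⁻ base T∈
    ... | u , u∈ , refl = u , ℕP.≤-pred (∈-upTo⁻ u∈) , refl

    ∈-family-suc⁻ : ∀ {m T} → T ∈ family (ℕ.suc m) →
                    ∃₂ λ w S → w ∈ digitVectors (ℕ.suc m) × S ∈ family m × T ≡ extend w S
    ∈-family-suc⁻ {m} = ∈-cartesianProductWith⁻ extend (digitVectors (ℕ.suc m)) (family m)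

    coef-≤ : ∀ {m} {w : Vec ℕ (ℕ.suc m)} → w ∈ digitVectors (ℕ.suc m) → ∀ k → coef w k ℕ.≤ ℕ.suc (g ℕ.+ g)
    coef-≤ {w = w₀ ∷ w} w∈ zero    = ℕ.s≤s (ℕP.+-monoʳ-≤ g (∈-digitVectors⁻ w∈ zero))
    coef-≤ {w = w₀ ∷ w} w∈ (suc k) = ℕP.≤-trans (∈-digitVectors⁻ w∈ (suc k)) (ℕP.m≤n⇒m≤1+n (ℕP.m≤m+n g g))

    coef-injective : ∀ {m} {w w′ : Vec ℕ (ℕ.suc m)} → (∀ k → coef w k ≡ coef w′ k) → w ≡ w′
    coef-injective {w = w₀ ∷ w} {w₀′ ∷ w′} eq = cong₂ _∷_
      (ℕP.+-cancelˡ-≡ h w₀ w₀′ (eq zero)) (lookup-injective w w′ (eq ∘ suc))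

    coef-· : ∀ {m} (w : Vec ℕ (ℕ.suc m)) (y : QVec (ℕ.suc m)) → coef w · y ≡ ι h * y zero + lookup w · y
    coef-· (w₀ ∷ w) y = begin
      ι (h ℕ.+ w₀) * y zero + rest         ≡⟨ cong (λ a → a * y zero + rest) (ι-+ h w₀) ⟩
      (ι h + ι w₀) * y zero + rest         ≡⟨ cong (_+ rest) (*-distribʳ-+ (y zero) (ι h) (ι w₀)) ⟩
      ι h * y zero + ι w₀ * y zero + rest  ≡⟨ +-assoc (ι h * y zero) (ι w₀ * y zero) rest ⟩
      ι h * y zero + lookup (w₀ ∷ w) · y   ∎
      where
      open ≡-Reasoning
      rest = lookup w · tail y

    family-entries : ∀ n {T} → T ∈ family n → ∀ i j → ∣ T i j ∣ ℕ.≤ ℕ.suc (g ℕ.+ g)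
    family-entries ℕ.zero T∈ i j with ∈-family-zero⁻ T∈
    ... | u , u≤g , refl = ℕ.s≤s (ℕP.≤-trans u≤g (ℕP.m≤m+n g g))
    family-entries (ℕ.suc m) T∈ i j with ∈-family-suc⁻ T∈
    ... | w , S , w∈ , S∈ , refl = extend-entries i j
      where
      extend-entries : ∀ i j → ∣ extend w S i j ∣ ℕ.≤ ℕ.suc (g ℕ.+ g)
      extend-entries zero    zero    = ℕ.s≤s ℕ.z≤n
      extend-entries zero    (suc j) = subst (ℕ._≤ ℕ.suc (g ℕ.+ g)) (sym (ℤP.∣-i∣≡∣i∣ (ℤ.+ coef w j))) (coef-≤ w∈ j)
      extend-entries (suc i) zero    = ℕ.z≤n
      extend-entries (suc i) (suc j) = family-entries m S∈ i j

    digitVectors-unique : ∀ m → Unique (digitVectors m)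
    digitVectors-unique ℕ.zero    = All.[] ∷ []
    digitVectors-unique (ℕ.suc m) =
      UniqueP.cartesianProductWith⁺ _∷_ VecP.∷-injective (UniqueP.upTo⁺ h) (digitVectors-unique m)

    family-unique : ∀ n → AllPairs (λ S T → ¬ S ≐ₘ T) (family n)
    family-unique ℕ.zero = UniqueS.map⁺ (≡.setoid ℕ) (≐ₘ-setoid 1)
      (λ eq → ℕP.suc-injective (ℤP.+-injective (eq zero zero))) (UniqueP.upTo⁺ h)
    family-unique (ℕ.suc m) = UniqueS.cartesianProductWith⁺
      (≡.setoid (Vec ℕ (ℕ.suc m))) (≐ₘ-setoid (ℕ.suc m)) (≐ₘ-setoid (ℕ.suc (ℕ.suc m))) extend
      (λ eq → let c≗c′ , S≐T = border-injective eq in coef-injective c≗c′ , S≐T)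
      (digitVectors-unique (ℕ.suc m)) (family-unique m)

    length-digitVectors : ∀ m → length (digitVectors m) ≡ h ^ m
    length-digitVectors ℕ.zero    = refl
    length-digitVectors (ℕ.suc m) = trans (length-cartesianProductWith _∷_ (upTo h) (digitVectors m))
      (cong₂ ℕ._*_ (ListP.length-upTo h) (length-digitVectors m))

    length-family : ∀ n → length (family n) ≡ h ^ digitCount n
    length-family ℕ.zero    = trans (ListP.length-map base (upTo h))
      (trans (ListP.length-upTo h) (sym (ℕP.*-identityʳ h)))
    length-family (ℕ.suc m) = begin
      length (family (ℕ.suc m))
        ≡⟨ length-cartesianProductWith extend (digitVectors (ℕ.suc m)) (family m) ⟩
      length (digitVectors (ℕ.suc m)) ℕ.* length (family m)
        ≡⟨ cong₂ ℕ._*_ (length-digitVectors (ℕ.suc m)) (length-family m) ⟩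
      h ^ ℕ.suc m ℕ.* h ^ digitCount m
        ≡⟨ ℕP.^-distribˡ-+-* h (ℕ.suc m) (digitCount m) ⟨
      h ^ digitCount (ℕ.suc m)
        ∎
      where open ≡-Reasoning

    base-solves⁻ : ∀ u x → Solves (toQ (base u)) x → ι (ℕ.suc u) * x zero ≡ 1ℚ
    base-solves⁻ u x sol = trans (sym (+-identityʳ (ι (ℕ.suc u) * x zero))) (sol zero)

    extend-solves⁻ : ∀ {m} w S (x : QVec (ℕ.suc (ℕ.suc m))) → Solves (toQ (extend w S)) x →
                     x zero ≡ ι h * x (suc zero) + lookup w · tail x × Solves (toQ S) (tail x)
    extend-solves⁻ w S x sol =
      let x₀≡ , tail-sol = bordered-solves⁻ (ι ∘ coef w) {x = x}
                             (λ i → trans (sym (mulVec-congˡ (toQ-border (coef w) S) x i)) (sol i))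
      in trans x₀≡ (coef-· w (tail x)) , tail-sol

    family-solution-superincreasing : ∀ n {T} x → T ∈ family n → Solves (toQ T) x → Superincreasing g x
    family-solution-superincreasing ℕ.zero x T∈ sol with ∈-family-zero⁻ T∈
    ... | u , _ , refl = subst (_< x zero) (sym (*-zeroʳ (ι g))) x₀>0 ∷ []
      where
      x₀>0 : 0ℚ < x zero
      x₀>0 = *-inverse-positive (ι-nonNeg (ℕ.suc u)) (base-solves⁻ u x sol)
    family-solution-superincreasing (ℕ.suc m) x T∈ sol with ∈-family-suc⁻ T∈
    ... | w , S , _ , S∈ , refl =
      let x₀≡ , tail-sol = extend-solves⁻ w S x sol
          tail-superincreasing = family-solution-superincreasing m (tail x) S∈ tail-sol
      in superincreasing-cons tail-superincreasing (begin
           ι h * x (suc zero)                      ≡⟨ +-identityʳ (ι h * x (suc zero)) ⟨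
           ι h * x (suc zero) + 0ℚ                 ≤⟨ +-monoʳ-≤ (ι h * x (suc zero)) (·-nonNeg (lookup w) tail-superincreasing) ⟩
           ι h * x (suc zero) + lookup w · tail x  ≡⟨ x₀≡ ⟨
           x zero                                  ∎)
      where open ≤-Reasoning

    family-solution-injective : ∀ n {S T} x → S ∈ family n → T ∈ family n →
                                Solves (toQ S) x → Solves (toQ T) x → S ≐ₘ T
    family-solution-injective ℕ.zero x S∈ T∈ solS solT with ∈-family-zero⁻ S∈ | ∈-family-zero⁻ T∈
    ... | u , _ , refl | v , _ , refl =
      λ _ _ → cong ℤ.+_ (ι-injective (*-inverse-unique (base-solves⁻ u x solS) (base-solves⁻ v x solT)))
    family-solution-injective (ℕ.suc m) x S∈ T∈ solS solT with ∈-family-suc⁻ S∈ | ∈-family-suc⁻ T∈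
    ... | w , S , w∈ , S∈′ , refl | w′ , T , w′∈ , T∈′ , refl =
      let x₀≡ , tail-solS = extend-solves⁻ w S x solS
          x₀≡′ , tail-solT = extend-solves⁻ w′ T x solT
          digitSums≡ = ∙-cancelˡ (ι h * x (suc zero)) (lookup w · tail x) (lookup w′ · tail x)
                         (trans (sym x₀≡) x₀≡′)
          w≡w′ = lookup-injective w w′ (·-injective (family-solution-superincreasing m (tail x) S∈′ tail-solS)
                   (∈-digitVectors⁻ w∈) (∈-digitVectors⁻ w′∈) digitSums≡)
      in border-cong (λ k → cong (λ v → coef v k) w≡w′)
                     (family-solution-injective m (tail x) S∈′ T∈′ tail-solS tail-solT)

    family-lastColumn-injective : ∀ n {S T Sinv Tinv} → S ∈ family n → T ∈ family n →
                                  IsInverse (toQ S) Sinv → IsInverse (toQ T) Tinv →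
                                  mulVec Sinv (lastBasis n) ≐ᵥ mulVec Tinv (lastBasis n) → S ≐ₘ T
    family-lastColumn-injective n {S} {T} {Sinv} {Tinv} S∈ T∈ S⁻¹ T⁻¹ columns≡ =
      family-solution-injective n (mulVec Sinv (lastBasis n)) S∈ T∈
        (mulVec-inverse {A = toQ S} {Sinv} S⁻¹ (lastBasis n))
        (λ i → trans (mulVec-congʳ (toQ T) columns≡ i) (mulVec-inverse {A = toQ T} {Tinv} T⁻¹ (lastBasis n) i))

    family-nonSingular : ∀ n {T} → T ∈ family n → NonSingular T
    family-nonSingular ℕ.zero T∈ with ∈-family-zero⁻ T∈
    ... | u , _ , refl = (λ _ _ → 1/ a) , (λ { zero zero → trans (+-identityʳ _) (*-inverseʳ a) })
                                       , (λ { zero zero → trans (+-identityʳ _) (*-inverseˡ a) })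
      where
      a = ι (ℕ.suc u)
      instance
        a≢0 : NonZero a
        a≢0 = subst NonZero (sym (ι≡mkℚ (ℕ.suc u))) _
    family-nonSingular (ℕ.suc m) T∈ with ∈-family-suc⁻ T∈
    ... | w , S , _ , S∈ , refl =
      let B , S⁻¹ = family-nonSingular m S∈
      in borderedInverse (ι ∘ coef w) B ,
         IsInverse-respˡ {B = borderedInverse (ι ∘ coef w) B} (λ i j → sym (toQ-border (coef w) S i j))
           (bordered-isInverse (ι ∘ coef w) {B = B} S⁻¹)

open import Data.Nat using (ℕ; suc; _*_; _^_; _≤_)
open import Data.Integer using (∣_∣)
open import Data.List using (List; length)
open import Data.List.Membership.Propositional using (_∈_)
open import Data.List.Relation.Unary.AllPairs using (AllPairs)
open import Data.Product using (∃; _×_)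
open import Relation.Nullary using (¬_)

open import Data.Nat using (zero; _+_; z≤n; s≤s; ⌊_/2⌋; ⌈_/2⌉; NonZero)
open import Data.Nat.Properties
open import Data.Nat.Tactic.RingSolver using (solve-∀)
open import Data.Product using (_,_)
open import Relation.Binary.PropositionalEquality using (_≡_; sym; cong; subst)
open Construction

⌈n/2⌉≤1+⌊n/2⌋ : ∀ n → ⌈ n /2⌉ ≤ suc ⌊ n /2⌋
⌈n/2⌉≤1+⌊n/2⌋ zero          = z≤n
⌈n/2⌉≤1+⌊n/2⌋ (suc zero)    = s≤s z≤n
⌈n/2⌉≤1+⌊n/2⌋ (suc (suc n)) = s≤s (⌈n/2⌉≤1+⌊n/2⌋ n)

⌊n/2⌋+⌊n/2⌋≤n : ∀ n → ⌊ n /2⌋ + ⌊ n /2⌋ ≤ n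
⌊n/2⌋+⌊n/2⌋≤n n = ≤-trans (+-monoʳ-≤ ⌊ n /2⌋ (⌊n/2⌋≤⌈n/2⌉ n)) (≤-reflexive (⌊n/2⌋+⌈n/2⌉≡n n))

n≤1+⌊n/2⌋+⌊n/2⌋ : ∀ n → n ≤ suc (⌊ n /2⌋ + ⌊ n /2⌋)
n≤1+⌊n/2⌋+⌊n/2⌋ n = begin
  n                         ≡⟨ sym (⌊n/2⌋+⌈n/2⌉≡n n) ⟩
  ⌊ n /2⌋ + ⌈ n /2⌉         ≤⟨ +-monoʳ-≤ ⌊ n /2⌋ (⌈n/2⌉≤1+⌊n/2⌋ n) ⟩
  ⌊ n /2⌋ + suc ⌊ n /2⌋     ≡⟨ +-suc ⌊ n /2⌋ ⌊ n /2⌋ ⟩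
  suc (⌊ n /2⌋ + ⌊ n /2⌋)   ∎
  where open ≤-Reasoning

1+n≤[1+⌊n/2⌋]² : ∀ n → 2 ≤ n → suc n ≤ suc ⌊ n /2⌋ * suc ⌊ n /2⌋
1+n≤[1+⌊n/2⌋]² n 2≤n = begin
  suc n                  ≤⟨ s≤s (n≤1+⌊n/2⌋+⌊n/2⌋ n) ⟩
  suc (suc (g + g))      ≡⟨ double g ⟩
  2 * suc g              ≤⟨ *-monoˡ-≤ (suc g) (s≤s (⌊n/2⌋-mono 2≤n)) ⟩
  suc g * suc g          ∎
  where
  open ≤-Reasoning
  g = ⌊ n /2⌋
  double : ∀ g → suc (suc (g + g)) ≡ 2 * suc g
  double = solve-∀

square≤4*digitCount : ∀ n → suc n * suc n ≤ 4 * digitCount n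
square≤4*digitCount zero    = s≤s z≤n
square≤4*digitCount (suc n) = begin
  suc (suc n) * suc (suc n)               ≡⟨ expand n ⟩
  suc n * suc n + (3 + 2 * n)             ≤⟨ +-mono-≤ (square≤4*digitCount n)
                                                       (+-monoʳ-≤ 3 (*-monoˡ-≤ n {2} {4} (s≤s (s≤s z≤n)))) ⟩
  4 * digitCount n + (3 + 4 * n)          ≤⟨ +-monoʳ-≤ (4 * digitCount n) (n≤1+n (3 + 4 * n)) ⟩
  4 * digitCount n + (4 + 4 * n)          ≡⟨ regroup n (digitCount n) ⟩
  4 * digitCount (suc n)                  ∎
  where
  open ≤-Reasoning
  expand : ∀ n → suc (suc n) * suc (suc n) ≡ suc n * suc n + (3 + 2 * n)
  expand = solve-∀
  regroup : ∀ n e → 4 * e + (4 + 4 * n) ≡ 4 * (suc n + e)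
  regroup = solve-∀

^-bound : ∀ {t d} h e .{{_ : NonZero h}} → t ≤ h * h → d ≤ 4 * e → t ^ d ≤ (h ^ e) ^ 8
^-bound {t} {d} h e t≤h² d≤4e = begin
  t ^ d              ≤⟨ ^-monoˡ-≤ d t≤h² ⟩
  (h * h) ^ d        ≡⟨ cong (_^ d) (cong (h *_) (sym (*-identityʳ h))) ⟩
  (h ^ 2) ^ d        ≡⟨ ^-*-assoc h 2 d ⟩
  h ^ (2 * d)        ≤⟨ ^-monoʳ-≤ h (*-monoʳ-≤ 2 d≤4e) ⟩
  h ^ (2 * (4 * e))  ≡⟨ cong (h ^_) (regroup e) ⟩
  h ^ (e * 8)        ≡⟨ ^-*-assoc h e 8 ⟨
  (h ^ e) ^ 8        ∎
  where
  open ≤-Reasoning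
  regroup : ∀ e → 2 * (4 * e) ≡ e * 8
  regroup = solve-∀

family-large : ∀ n {s} → 2 ≤ s → suc s ^ (suc n * suc n) ≤ length (Family.family ⌊ s /2⌋ n) ^ 8
family-large n {s} 2≤s =
  subst (λ size → suc s ^ (suc n * suc n) ≤ size ^ 8) (sym (Family.length-family ⌊ s /2⌋ n))
    (^-bound (suc ⌊ s /2⌋) (digitCount n) (1+n≤[1+⌊n/2⌋]² s 2≤s) (square≤4*digitCount n))

lemma3p4 : ∃ λ (k : ℕ) → 1 ≤ k × ((n : ℕ) → ∃ λ (t₀ : ℕ) → (t : ℕ) → t₀ ≤ t →
             ∃ λ (H : List (IntMatrix (suc n))) →
               AllPairs (λ S T → ¬ (S ≐ₘ T)) H
               × ((S : IntMatrix (suc n)) → S ∈ H → ∀ i j → ∣ S i j ∣ ≤ t)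
               × (t ^ (suc n * suc n) ≤ length H ^ k)
               × ((T : IntMatrix (suc n)) → T ∈ H → NonSingular T)
               × ((S T : IntMatrix (suc n)) → S ∈ H → T ∈ H → ¬ (S ≐ₘ T) →
                   (Sinv Tinv : QMatrix (suc n)) → IsInverse (toQ S) Sinv → IsInverse (toQ T) Tinv →
                   ¬ (mulVec Sinv (lastBasis n) ≐ᵥ mulVec Tinv (lastBasis n))))
lemma3p4 = 8 , s≤s z≤n , λ n → 3 , λ where
  (suc s) (s≤s 2≤s) → let open Family ⌊ s /2⌋ in
      family n
    , family-unique n
    , (λ S S∈ i j → ≤-trans (family-entries n S∈ i j) (s≤s (⌊n/2⌋+⌊n/2⌋≤n s)))
    , family-large n 2≤s
    , (λ T → family-nonSingular n)
    , λ S T S∈ T∈ S≢T Sinv Tinv S⁻¹ T⁻¹ columns≡ →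
        S≢T (family-lastColumn-injective n {Sinv = Sinv} {Tinv} S∈ T∈ S⁻¹ T⁻¹ columns≡)
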